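{- For $r\ge1$ let $Q_r=(q_{ij})$ be the $r\times r$ integer matrix with $q_{ij}=j-i+1$ for $i\le j$, $q_{i+1,i}=-1$, and all other entries $0$. Then $\det Q_r=F_{2r}$.
   Context: $F_m$ denotes the Fibonacci numbers: $F_1=F_2=1$, $F_{m+1}=F_m+F_{m-1}$. -}

module Defs where

open import Data.Nat as ℕ using (ℕ; zero; suc)
open import Data.Integer as ℤ using (ℤ; +_; -_; _-_)
open import Data.Fin using (Fin; zero; suc; toℕ; punchIn)
open import Data.Bool using (if_then_else_)
open import Relation.Nullary.Decidable using (⌊_⌋)

-- Fibonacci numbers: F 0 = 0, F 1 = 1, F (m+2) = F (m+1) + F m
-- (so F 1 = F 2 = 1, as in the paper).
F : ℕ → ℕ
F zero = 0
F (suc zero) = 1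
F (suc (suc m)) = F (suc m) ℕ.+ F m

Matrix : ℕ → Set
Matrix n = Fin n → Fin n → ℤ

∑ : ∀ {n} → (Fin n → ℤ) → ℤ
∑ {zero} f = + 0
∑ {suc n} f = f zero ℤ.+ ∑ (λ i → f (suc i))

sgn : ℕ → ℤ
sgn zero = + 1
sgn (suc k) = - sgn k

det : ∀ {n} → Matrix n → ℤ
det {zero} M = + 1
det {suc n} M = ∑ (λ j → sgn (toℕ j) ℤ.* (M zero j ℤ.* det (λ i k → M (suc i) (punchIn j k))))

-- Q_r with 1-based indices i = toℕ a + 1, j = toℕ b + 1:
--   q_ij = j - i + 1  if i ≤ j,
--   q_ij = -1         if i = j + 1,
--   q_ij = 0          otherwise.
Q : (r : ℕ) → Matrix r
Q r a b =
  let i = suc (toℕ a) ; j = suc (toℕ b) in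
  if ⌊ i ℕ.≤? j ⌋ then (+ j) - (+ i) ℤ.+ + 1
  else if ⌊ i ℕ.≟ suc j ⌋ then - (+ 1)
  else + 0

module Submission where

-- Write D m = det Q_m.  The entry q_ij depends only on the pair (i, j) up to a
-- common shift of both indices, and the first column of Q_r is (1, -1, 0, ..., 0).
-- Expanding det Q_{n+1} along its first row, the minor obtained by deleting
-- column j (0-based) is block upper triangular: its first j columns have -1 on
-- the diagonal and zeros below it, and its lower-right block is Q_{n-j}.  Hence
-- that minor has determinant (-1)^j D (n - j), the sign cancels against the
-- cofactor sign, and
--     D (n + 1) = Σ_{j ≤ n} (j + 1) · D (n - j),      D 0 = 1.
-- The sequence e 0 = 1, e m = F_{2m} (m ≥ 1) satisfies the same recurrence,
-- because Σ_{k ≤ n} e (n - k) = F_{2n+1}; strong induction gives D = e.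

open import Defs
open import Data.Nat using (ℕ; suc; _*_)
open import Data.Integer using (+_)
open import Relation.Binary.PropositionalEquality using (_≡_)

open import Data.Nat as ℕ using (zero; _≤_; _<_; z≤n; s≤s)
import Data.Nat.Properties as ℕP
open import Data.Nat.Induction using (<-rec)
open import Data.Integer as ℤ using (ℤ; -_; _-_)
import Data.Integer.Properties as ℤP
import Algebra.Properties.CommutativeSemigroup as CommutativeSemigroupProperties
open import Data.Fin using (Fin; zero; suc; toℕ; punchIn)
open import Data.Bool using (if_then_else_)
open import Relation.Nullary using (yes; no; ¬_)
open import Relation.Nullary.Decidable using (⌊_⌋)
open import Data.Empty using (⊥-elim)
open import Relation.Binary.PropositionalEquality
  using (refl; sym; trans; cong; cong₂; module ≡-Reasoning)

∑-cong : ∀ {n} {f g : Fin n → ℤ} → (∀ i → f i ≡ g i) → ∑ f ≡ ∑ g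
∑-cong {zero} e = refl
∑-cong {suc n} e = cong₂ ℤ._+_ (e zero) (∑-cong (λ i → e (suc i)))

∑-vanishes : ∀ {n} {f : Fin n → ℤ} → (∀ i → f i ≡ + 0) → ∑ f ≡ + 0
∑-vanishes {zero} e = refl
∑-vanishes {suc n} e = cong₂ ℤ._+_ (e zero) (∑-vanishes (λ i → e (suc i)))

minor : ∀ {n} → Matrix (suc n) → Fin (suc n) → Matrix n
minor M j i k = M (suc i) (punchIn j k)

det-cong : ∀ {n} {M N : Matrix n} → (∀ i j → M i j ≡ N i j) → det M ≡ det N
det-cong {zero} e = refl
det-cong {suc n} e = ∑-cong (λ j →
  cong₂ (λ x y → sgn (toℕ j) ℤ.* (x ℤ.* y))
        (e zero j) (det-cong (λ i k → e (suc i) (punchIn j k))))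

term-vanishesˡ : ∀ s {x} y → x ≡ + 0 → s ℤ.* (x ℤ.* y) ≡ + 0
term-vanishesˡ s y refl = ℤP.*-zeroʳ s

term-vanishesʳ : ∀ s x {y} → y ≡ + 0 → s ℤ.* (x ℤ.* y) ≡ + 0
term-vanishesʳ s x refl = trans (cong (s ℤ.*_) (ℤP.*-zeroʳ x)) (ℤP.*-zeroʳ s)

mutual
  -- A matrix whose first column is zero has determinant zero: the first term of
  -- the expansion has a zero entry, every other minor again has a zero first column.
  det-zeroColumn : ∀ {n} (M : Matrix (suc n)) → (∀ i → M i zero ≡ + 0) → det M ≡ + 0
  det-zeroColumn M zeroCol = ∑-vanishes term
    where
    term : ∀ j → sgn (toℕ j) ℤ.* (M zero j ℤ.* det (minor M j)) ≡ + 0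
    term zero = term-vanishesˡ (sgn 0) _ (zeroCol zero)
    term (suc j) = term-vanishesʳ (sgn (toℕ (suc j))) (M zero (suc j))
                     (det-laterMinor M j (λ i → zeroCol (suc i)))

  det-laterMinor : ∀ {n} (M : Matrix (suc n)) (j : Fin n) → (∀ i → M (suc i) zero ≡ + 0) →
                   det (minor M (suc j)) ≡ + 0
  det-laterMinor {suc n} M j belowZero = det-zeroColumn (minor M (suc j)) belowZero

-- If the first column vanishes below the corner, the corner entry factors out:
-- all minors except the first have a zero first column.
det-cornerColumn : ∀ {n} (M : Matrix (suc n)) → (∀ i → M (suc i) zero ≡ + 0) →
                   det M ≡ M zero zero ℤ.* det (minor M zero)
det-cornerColumn {n} M belowZero = begin
  + 1 ℤ.* corner ℤ.+ ∑ rest ≡⟨ cong (ℤ._+_ (+ 1 ℤ.* corner)) (∑-vanishes restZero) ⟩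
  + 1 ℤ.* corner ℤ.+ + 0    ≡⟨ ℤP.+-identityʳ _ ⟩
  + 1 ℤ.* corner            ≡⟨ ℤP.*-identityˡ corner ⟩
  corner                    ∎
  where
  open ≡-Reasoning
  corner : ℤ
  corner = M zero zero ℤ.* det (minor M zero)
  rest : Fin n → ℤ
  rest j = sgn (toℕ (suc j)) ℤ.* (M zero (suc j) ℤ.* det (minor M (suc j)))
  restZero : ∀ j → rest j ≡ + 0
  restZero j = term-vanishesʳ (sgn (toℕ (suc j))) (M zero (suc j))
                 (det-laterMinor M j belowZero)

sgn-square : ∀ k → sgn k ℤ.* sgn k ≡ + 1
sgn-square zero = refl
sgn-square (suc zero) = refl
sgn-square (suc (suc k)) rewrite ℤP.neg-involutive (sgn k) = sgn-square k

sgn-cancel : ∀ k c d → sgn k ℤ.* (c ℤ.* (sgn k ℤ.* d)) ≡ c ℤ.* d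
sgn-cancel k c d = begin
  s ℤ.* (c ℤ.* (s ℤ.* d)) ≡⟨ cong (s ℤ.*_) (CommutativeSemigroupProperties.x∙yz≈y∙xz ℤP.*-commutativeSemigroup c s d) ⟩
  s ℤ.* (s ℤ.* (c ℤ.* d)) ≡⟨ sym (ℤP.*-assoc s s (c ℤ.* d)) ⟩
  s ℤ.* s ℤ.* (c ℤ.* d)   ≡⟨ cong (ℤ._* (c ℤ.* d)) (sgn-square k) ⟩
  + 1 ℤ.* (c ℤ.* d)       ≡⟨ ℤP.*-identityˡ (c ℤ.* d) ⟩
  c ℤ.* d                 ∎
  where
  open ≡-Reasoning
  s : ℤ
  s = sgn k

-- entry x y = q_{x+1,y+1}: it is invariant under shifting both indices, so it is
-- determined by its values on the first row (q_{1,y+1} = y + 1) and on the first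
-- column (q_{2,1} = -1 and q_{i,1} = 0 for i ≥ 3).
entry : ℕ → ℕ → ℤ
entry zero y = + suc y
entry (suc x) (suc y) = entry x y
entry (suc zero) zero = - (+ 1)
entry (suc (suc x)) zero = + 0

entry-upper : ∀ x y → x ≤ y → entry x y ≡ + suc (y ℕ.∸ x)
entry-upper zero y z≤n = refl
entry-upper (suc x) (suc y) (s≤s x≤y) = entry-upper x y x≤y

entry-subdiagonal : ∀ y → entry (suc y) y ≡ - (+ 1)
entry-subdiagonal zero = refl
entry-subdiagonal (suc y) = entry-subdiagonal y

entry-lower : ∀ x y → ¬ x ≤ y → ¬ x ≡ suc y → entry x y ≡ + 0
entry-lower zero y x≰y _ = ⊥-elim (x≰y z≤n)
entry-lower (suc zero) zero _ x≢1+y = ⊥-elim (x≢1+y refl)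
entry-lower (suc (suc x)) zero _ _ = refl
entry-lower (suc x) (suc y) x≰y x≢1+y =
  entry-lower x y (λ x≤y → x≰y (s≤s x≤y)) (λ x≡1+y → x≢1+y (cong suc x≡1+y))

Q-entry : ∀ r (a b : Fin r) → Q r a b ≡ entry (toℕ a) (toℕ b)
Q-entry r a b = cases (toℕ a) (toℕ b)
  where
  cases : ∀ x y →
    (if ⌊ suc x ℕ.≤? suc y ⌋ then (+ suc y) - (+ suc x) ℤ.+ + 1
     else if ⌊ suc x ℕ.≟ suc (suc y) ⌋ then - (+ 1) else + 0) ≡ entry x y
  cases x y with suc x ℕ.≤? suc y
  ... | yes (s≤s x≤y) = begin
        (+ suc y) - (+ suc x) ℤ.+ + 1 ≡⟨ cong (ℤ._+ + 1) (ℤP.⊖-≥ (s≤s x≤y)) ⟩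
        + (y ℕ.∸ x) ℤ.+ + 1           ≡⟨ cong +_ (ℕP.+-comm (y ℕ.∸ x) 1) ⟩
        + suc (y ℕ.∸ x)               ≡⟨ sym (entry-upper x y x≤y) ⟩
        entry x y                     ∎
    where open ≡-Reasoning
  ... | no x≰y with suc x ℕ.≟ suc (suc y)
  ...   | yes refl = sym (entry-subdiagonal y)
  ...   | no x≢1+y =
          sym (entry-lower x y (λ x≤y → x≰y (s≤s x≤y)) (λ x≡1+y → x≢1+y (cong suc x≡1+y)))

D : ℕ → ℤ
D m = det (Q m)

-- Deleting the first row and column j of Q_{n+1} leaves a matrix with
-- determinant (-1)^j D (n - j): for j = 0 it is Q_n by shift invariance; for
-- j > 0 its first column is (-1, 0, ..., 0) and peeling off the corner leaves
-- the corresponding minor of Q_n at column j - 1.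
det-minor-Q : ∀ n (j : Fin (suc n)) → det (minor (Q (suc n)) j) ≡ sgn (toℕ j) ℤ.* D (n ℕ.∸ toℕ j)
det-minor-Q n zero = begin
  det (minor (Q (suc n)) zero) ≡⟨ det-cong shifted ⟩
  D n                          ≡⟨ sym (ℤP.*-identityˡ (D n)) ⟩
  + 1 ℤ.* D n                  ∎
  where
  open ≡-Reasoning
  shifted : ∀ a b → Q (suc n) (suc a) (suc b) ≡ Q n a b
  shifted a b = trans (Q-entry (suc n) (suc a) (suc b)) (sym (Q-entry n a b))
det-minor-Q (suc n) (suc j) = begin
  det M                                      ≡⟨ det-cornerColumn M belowCorner ⟩
  M zero zero ℤ.* det (minor M zero)          ≡⟨ cong₂ ℤ._*_ (Q-entry (suc (suc n)) (suc zero) zero)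
                                                   (det-cong shifted) ⟩
  - (+ 1) ℤ.* det (minor (Q (suc n)) j)      ≡⟨ ℤP.-1*i≡-i _ ⟩
  - det (minor (Q (suc n)) j)                ≡⟨ cong -_ (det-minor-Q n j) ⟩
  - (sgn (toℕ j) ℤ.* D (n ℕ.∸ toℕ j))        ≡⟨ ℤP.neg-distribˡ-* (sgn (toℕ j)) _ ⟩
  sgn (toℕ (suc j)) ℤ.* D (n ℕ.∸ toℕ j)      ∎
  where
  open ≡-Reasoning
  M : Matrix (suc n)
  M = minor (Q (suc (suc n))) (suc j)
  belowCorner : ∀ i → M (suc i) zero ≡ + 0
  belowCorner i = Q-entry (suc (suc n)) (suc (suc i)) zero
  shifted : ∀ i k → minor M zero i k ≡ minor (Q (suc n)) j i k
  shifted i k = trans (Q-entry (suc (suc n)) (suc (suc i)) (suc (punchIn j k)))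
                      (sym (Q-entry (suc n) (suc i) (punchIn j k)))

D-recurrence : ∀ n → D (suc n) ≡ ∑ (λ (j : Fin (suc n)) → + suc (toℕ j) ℤ.* D (n ℕ.∸ toℕ j))
D-recurrence n = ∑-cong λ j →
  trans (cong₂ (λ x y → sgn (toℕ j) ℤ.* (x ℤ.* y)) (Q-entry (suc n) zero j) (det-minor-Q n j))
        (sgn-cancel (toℕ j) (+ suc (toℕ j)) (D (n ℕ.∸ toℕ j)))

sumTo : ℕ → (ℕ → ℕ) → ℕ
sumTo zero g = 0
sumTo (suc n) g = g 0 ℕ.+ sumTo n (λ k → g (suc k))

sumTo-+ : ∀ n f g → sumTo n (λ k → f k ℕ.+ g k) ≡ sumTo n f ℕ.+ sumTo n g
sumTo-+ zero f g = refl
sumTo-+ (suc n) f g = begin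
  f 0 ℕ.+ g 0 ℕ.+ sumTo n (λ k → f (suc k) ℕ.+ g (suc k))
    ≡⟨ cong (f 0 ℕ.+ g 0 ℕ.+_) (sumTo-+ n (λ k → f (suc k)) (λ k → g (suc k))) ⟩
  f 0 ℕ.+ g 0 ℕ.+ (sumTo n (λ k → f (suc k)) ℕ.+ sumTo n (λ k → g (suc k)))
    ≡⟨ ℕP.+-assoc (f 0) (g 0) _ ⟩
  f 0 ℕ.+ (g 0 ℕ.+ (sumTo n (λ k → f (suc k)) ℕ.+ sumTo n (λ k → g (suc k))))
    ≡⟨ cong (f 0 ℕ.+_) (CommutativeSemigroupProperties.x∙yz≈y∙xz ℕP.+-commutativeSemigroup
                    (g 0) (sumTo n (λ k → f (suc k))) (sumTo n (λ k → g (suc k)))) ⟩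
  f 0 ℕ.+ (sumTo n (λ k → f (suc k)) ℕ.+ (g 0 ℕ.+ sumTo n (λ k → g (suc k))))
    ≡⟨ sym (ℕP.+-assoc (f 0) _ _) ⟩
  f 0 ℕ.+ sumTo n (λ k → f (suc k)) ℕ.+ (g 0 ℕ.+ sumTo n (λ k → g (suc k))) ∎
  where open ≡-Reasoning

∑-sumTo : ∀ n h → ∑ {n} (λ j → + h (toℕ j)) ≡ + sumTo n h
∑-sumTo zero h = refl
∑-sumTo (suc n) h =
  trans (cong (ℤ._+_ (+ h 0)) (∑-sumTo n (λ k → h (suc k)))) (sym (ℤP.pos-+ (h 0) _))

evenFib : ℕ → ℕ
evenFib zero = 1
evenFib (suc m) = F (suc m ℕ.+ suc m)

evenFib-sum : ∀ n → sumTo (suc n) (λ k → evenFib (n ℕ.∸ k)) ≡ F (suc (n ℕ.+ n))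
evenFib-sum zero = refl
evenFib-sum (suc n) rewrite evenFib-sum n | ℕP.+-suc n n = refl

-- Splitting the weight k + 2 = 1 + (k + 1) in the sum for n + 1 reduces it,
-- by evenFib-sum and induction, to F_{2n+2} + (F_{2n+1} + F_{2n+2}) = F_{2n+4}.
evenFib-recurrence : ∀ n → sumTo (suc n) (λ k → suc k * evenFib (n ℕ.∸ k)) ≡ evenFib (suc n)
evenFib-recurrence zero = refl
evenFib-recurrence (suc n) = begin
  evenFib (suc n) ℕ.+ 0 ℕ.+ sumTo (suc n) (λ k → suc (suc k) * evenFib (n ℕ.∸ k))
    ≡⟨ cong₂ ℕ._+_ (ℕP.+-identityʳ (evenFib (suc n)))
                   (sumTo-+ (suc n) (λ k → evenFib (n ℕ.∸ k)) (λ k → suc k * evenFib (n ℕ.∸ k))) ⟩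
  evenFib (suc n) ℕ.+ (sumTo (suc n) (λ k → evenFib (n ℕ.∸ k))
                       ℕ.+ sumTo (suc n) (λ k → suc k * evenFib (n ℕ.∸ k)))
    ≡⟨ cong₂ (λ u v → evenFib (suc n) ℕ.+ (u ℕ.+ v)) (evenFib-sum n) (evenFib-recurrence n) ⟩
  evenFib (suc n) ℕ.+ (F (suc (n ℕ.+ n)) ℕ.+ evenFib (suc n))
    ≡⟨ fibonacciStep ⟩
  evenFib (suc (suc n)) ∎
  where
  open ≡-Reasoning
  -- F_{2n+2} + (F_{2n+1} + F_{2n+2}) = F_{2n+2} + F_{2n+3} = F_{2n+4}.
  fibonacciStep : evenFib (suc n) ℕ.+ (F (suc (n ℕ.+ n)) ℕ.+ evenFib (suc n)) ≡ evenFib (suc (suc n))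
  fibonacciStep rewrite ℕP.+-suc n (suc n) | ℕP.+-suc n n =
    sym (ℕP.+-assoc (F (suc (suc (n ℕ.+ n)))) _ _)

D≡evenFib : ∀ m → D m ≡ + evenFib m
D≡evenFib = <-rec (λ m → D m ≡ + evenFib m) step
  where
  step : ∀ m → (∀ {k} → k < m → D k ≡ + evenFib k) → D m ≡ + evenFib m
  step zero _ = refl
  step (suc n) ih = begin
    D (suc n)
      ≡⟨ D-recurrence n ⟩
    ∑ (λ (j : Fin (suc n)) → + suc (toℕ j) ℤ.* D (n ℕ.∸ toℕ j))
      ≡⟨ ∑-cong {suc n} (λ j → trans (cong (+ suc (toℕ j) ℤ.*_) (ih (s≤s (ℕP.m∸n≤m n (toℕ j)))))
                             (sym (ℤP.pos-* (suc (toℕ j)) (evenFib (n ℕ.∸ toℕ j))))) ⟩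
    ∑ (λ (j : Fin (suc n)) → + (suc (toℕ j) * evenFib (n ℕ.∸ toℕ j)))
      ≡⟨ ∑-sumTo (suc n) (λ k → suc k * evenFib (n ℕ.∸ k)) ⟩
    + sumTo (suc n) (λ k → suc k * evenFib (n ℕ.∸ k))
      ≡⟨ cong +_ (evenFib-recurrence n) ⟩
    + evenFib (suc n) ∎
    where open ≡-Reasoning

mainTheorem9 : (r : ℕ) → det (Q (suc r)) ≡ + F (2 * suc r)
mainTheorem9 r = begin
  det (Q (suc r))         ≡⟨ D≡evenFib (suc r) ⟩
  + F (suc r ℕ.+ suc r)   ≡⟨ cong (λ k → + F (suc r ℕ.+ k)) (sym (ℕP.+-identityʳ (suc r))) ⟩
  + F (2 * suc r)         ∎
  where open ≡-Reasoning
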